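{- Let $P$ be a program and $\sigma\in\mathrm{C}_{\mathrm{Power}}(P)$. Then a load $(t,i)$ reads its value from a store $(t,i')$ via an EARLY transition if and only if (1) $\sigma=\sigma_1\cdot(\mathrm{ld},t,i,a)\cdot\sigma_2\cdot(\mathrm{commit},t,i',k,a)\cdot\sigma_3$ for some address $a$, key $k$, and $i'\in[1..i-1]$, and (2) $\sigma_3$ contains no event of the form $(\mathrm{commit},t,j,k',a)$ with $j\in[i'+1..i-1]$ and arbitrary $k'$.
   Context: Programs. Fix a finite set $D$ of values, which also serves as the set of addresses, with $0\in D$; a finite set $\mathit{Reg}$ of registers taking values in $D$; and a set of functions over $D\cup\{\bot\}$, each returning $\bot$ iff some argument is $\bot$. Expressions are built from constants in $D$, registers, and these functions. Commands are: loads $r\leftarrow \mathrm{mem}[e]$, stores $\mathrm{mem}[e]\leftarrow e'$, local assignments $r\leftarrow e$, and $\mathrm{assume}(e)$. A program $P=T_1\cdots T_n$ is a finite sequence of threads with ids $\mathit{Tid}=\{1,\dots,n\}$; thread $T_t$ is a finite automaton with control states $Q_t$ (all final), initial state $q^0_t$, and a finite set $I_t$ of transitions (called instructions) labeled by commands. An instruction $(t,i)$ is the $i$-th fetched instruction of thread $t$. Power semantics (Power automaton). A state is $(R,(co,prop))$. For each thread $t$, $R(t)=(F,C,L)$ where $F\in I_t^*$ is the sequence of fetched instructions, $C\subseteq[1..|F|]$ the committed indices, and $L:[1..|F|]\to\{\bot\}\cup\{\mathit{init}_a: a\in D\}\cup \mathit{Tid}\times\mathbb N$ records the store read by each load ($\mathit{init}_a$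 is an initial store of value $0$ to address $a$). $co$ assigns rational coherence keys to committed stores (and key $0$ to initial stores); $prop(t,a)$ is the last store to address $a$ propagated to thread $t$. Initially all $F$ are empty, $C=\emptyset$, $L\equiv\bot$, no program store has a key, and $prop(t,a)=\mathit{init}_a$. For the $i$-th fetched instruction of thread $t$, $\mathit{eval}(t,i,e)$ is: $e$ if $e\in D$; $f(\mathit{eval}(t,i,e_1),\dots)$ for $e=f(e_1,\dots)$; for a register $r$, let $i'<i$ be the greatest index such that $F[i']$ is an assignment or a load to $r$: if none, $0$; if $F[i']$ is $r\leftarrow e_v$, then $\mathit{eval}(t,i',e_v)$; if $F[i']$ is a load, then $\bot$ if $L[i']=\bot$, $0$ if $L[i']$ is an initial store, and otherwise the value argument of store $L[i']$. $\mathit{getaddr}(t,i)$ is the evaluated address expression of a load/store and $\top$ for other instructions; $\mathit{getvalue}(t,i)$ is the evaluated value expression of a store, assignment or assume, and $\top$ for loads. Address and data dependencies of instruction $i$ are the earlier instructions defining (recursively) the registers in its address, resp.\ value expression; control dependencies are all earlier assume instructions. Transitions (labels in parentheses): (FETCH) $(\mathrm{fetch},t,\iota)$: append instruction $\iota\in I_t$ to $F$ if its source state is the target of the last fetched instruction (or $q^0_t$ if $F$ is empty). (LOAD) $(\mathrm{ld},t,i,a)$: if $F[i]$ is a load, $L[i]=\bot$, $a=\mathit{getaddr}(t,i)\ne\bot$, set $L[i]:=prop(t,a)$. (EARLY) $(\mathrm{ld},t,i,a)$: if $F[i]$ is a load, $L[i]=\bot$, $a=\mathit{getaddr}(t,i)\neq\bot$,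 and the greatest $i'<i$ such that $F[i']$ is a store with $\mathit{getaddr}(t,i')\in\{a,\bot\}$ satisfies $\mathit{getaddr}(t,i')=a$, $\mathit{getvalue}(t,i')\ne\bot$, $i'\notin C$, set $L[i]:=(t,i')$. (COMMIT) $(\mathrm{commit},t,i)$ for a non-store $i\notin C$: requires all address, data, control dependencies committed, $\mathit{getaddr},\mathit{getvalue}\ne\bot$, if the address $a\ne\top$ then all $i'<i$ with $\mathit{getaddr}(t,i')\in\{a,\bot\}$ committed, $L[i]\ne\bot$ for loads, value $\neq0$ for assumes; adds $i$ to $C$. (STORE) $(\mathrm{commit},t,i,k,a)$: same preconditions for a store $i$ with address $a$, choosing a coherence key $k\in\mathbb Q$ not used by any other store; sets $co(t,i):=k$, adds $i$ to $C$, and is immediately followed by propagation of this store to thread $t$. (PROP) $(\mathrm{prop},t,t',i',a)$: if store $(t',i')$ is committed, has address $a$, and $co(prop(t,a))<co(t',i')$, set $prop(t,a):=(t',i')$. Final states: every fetched instruction is committed; for loads $i'<i$ of the same thread and address, $co(L[i'])\le co(L[i])$; for a store $i'$ and a load $i$ of the same thread and address with $i'<i$, $co(t,i')\le co(L[i])$. $\mathrm{C}_{\mathrm{Power}}(P)$ is the set of label sequences leading from the initial state to a final state. -}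

module Defs where

open import Data.Nat using (ℕ; zero; suc; _∸_; _<_; _≤_)
open import Data.Fin as Fin using (Fin)
open import Data.Bool using (Bool; true; false; if_then_else_)
open import Data.Maybe using (Maybe; just; nothing)
open import Data.List using (List; []; _∷_; _∷ʳ_; length)
open import Data.List.Membership.Propositional using (_∈_)
open import Data.Vec using (Vec; []; _∷_; lookup)
open import Data.Vec.Relation.Unary.Any using (Any)
open import Data.Product using (Σ; ∃; _×_; _,_)
open import Data.Sum using (_⊎_)
open import Data.Empty using (⊥)
open import Data.Unit using (⊤)
open import Relation.Nullary using (¬_)
open import Relation.Nullary.Decidable using (⌊_⌋)
open import Relation.Binary.PropositionalEquality using (_≡_; _≢_)
open import Data.Rational as ℚ using (ℚ; 0ℚ)

-- 1-based list access: at xs i = xs[i] for 1 ≤ i ≤ |xs|, otherwise nothing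
at : ∀ {A : Set} → List A → ℕ → Maybe A
at _        zero          = nothing
at []       (suc _)       = nothing
at (x ∷ _)  (suc zero)    = just x
at (_ ∷ xs) (suc (suc i)) = at xs (suc i)

updℕ : ∀ {A : Set} → (ℕ → A) → ℕ → A → ℕ → A
updℕ f i x j = if ⌊ Data.Nat._≟_ j i ⌋ then x else f j

updFin : ∀ {n} {A : Set} → (Fin n → A) → Fin n → A → Fin n → A
updFin f i x j = if ⌊ j Fin.≟ i ⌋ then x else f j

module _ {nD nR : ℕ} where

  D : Set
  D = Fin (suc nD)

  0D : D
  0D = Fin.zero

  Reg : Set
  Reg = Fin nR

  -- ⊥ is represented by nothing
  Val : Set
  Val = Maybe D

  -- Expressions: constants, registers, and applications of functions.
  -- A function over D ∪ {⊥} that returns ⊥ iff some argument is ⊥ is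
  -- exactly the strict lifting of a function D^k → D.
  data Expr : Set where
    const : D → Expr
    reg   : Reg → Expr
    fun   : {k : ℕ} → (Vec D k → D) → Vec Expr k → Expr

  data Cmd : Set where
    load   : Reg → Expr → Cmd
    store  : Expr → Expr → Cmd
    assign : Reg → Expr → Cmd
    assume : Expr → Cmd

  record Instr : Set where
    constructor ins
    field
      src : ℕ
      cmd : Cmd
      tgt : ℕ

  -- a thread: initial control state and finite set of instructions
  -- (all control states are final)
  record Thread : Set where
    field
      q0     : ℕ
      instrs : List Instr

  Program : ℕ → Set
  Program n = Vec Thread n

  -- stores: initial store of address a, or program store (t,i)
  data Src (n : ℕ) : Set where
    init : D → Src n
    st   : Fin n → ℕ → Src n

  record TState (n : ℕ) : Set where
    field
      F : List Instr
      C : ℕ → Bool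
      L : ℕ → Maybe (Src n)          -- store read by each load (nothing = ⊥)

  record State (n : ℕ) : Set where
    field
      R    : Fin n → TState n
      co   : Fin n → ℕ → Maybe ℚ
      prop : Fin n → D → Src n

  IsLoadC IsStoreC IsAssumeC : Cmd → Set
  IsLoadC (load _ _) = ⊤
  IsLoadC _          = ⊥
  IsStoreC (store _ _) = ⊤
  IsStoreC _           = ⊥
  IsAssumeC (assume _) = ⊤
  IsAssumeC _          = ⊥

  IsLoadAt IsStoreAt IsAssumeAt : List Instr → ℕ → Set
  IsLoadAt F i   = Σ Instr λ ι → at F i ≡ just ι × IsLoadC (Instr.cmd ι)
  IsStoreAt F i  = Σ Instr λ ι → at F i ≡ just ι × IsStoreC (Instr.cmd ι)
  IsAssumeAt F i = Σ Instr λ ι → at F i ≡ just ι × IsAssumeC (Instr.cmd ι)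

  definesReg : Reg → Cmd → Bool
  definesReg r (load r' _)   = ⌊ r Fin.≟ r' ⌋
  definesReg r (assign r' _) = ⌊ r Fin.≟ r' ⌋
  definesReg r _             = false

  definesAt : List Instr → ℕ → Reg → Bool
  definesAt F i r with at F i
  ... | nothing = false
  ... | just ι  = definesReg r (Instr.cmd ι)

  lastDef : List Instr → ℕ → Reg → Maybe ℕ
  lastDef F zero    r = nothing
  lastDef F (suc j) r = if definesAt F (suc j) r then just (suc j) else lastDef F j r

  addrExpr : Cmd → Maybe Expr
  addrExpr (load _ e)    = just e
  addrExpr (store e _)   = just e
  addrExpr _             = nothing

  valExpr : Cmd → Maybe Expr
  valExpr (load _ _)    = nothing
  valExpr (store _ e)   = just e
  valExpr (assign _ e)  = just e
  valExpr (assume e)    = just e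

  data RegIn (r : Reg) : Expr → Set where
    here  : RegIn r (reg r)
    inArg : ∀ {k} {f : Vec D k → D} {es : Vec Expr k} → Any (RegIn r) es → RegIn r (fun f es)

  -- Dep F j e i' : instruction i' is (recursively, through assignments) a
  -- defining instruction of a register of e, e being evaluated at an
  -- instruction that sees the indices 1..j
  data Dep (F : List Instr) : ℕ → Expr → ℕ → Set where
    direct : ∀ {j e r i'} → RegIn r e → lastDef F j r ≡ just i' → Dep F j e i'
    trans  : ∀ {j e r i'' ι e'' i'} → RegIn r e → lastDef F j r ≡ just i'' →
             at F i'' ≡ just ι → Instr.cmd ι ≡ assign r e'' →
             Dep F (i'' ∸ 1) e'' i' → Dep F j e i'

  AddrDep DataDep CtrlDep : List Instr → ℕ → ℕ → Set
  AddrDep F i i' = Σ Instr λ ι → Σ Expr λ e →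
    at F i ≡ just ι × addrExpr (Instr.cmd ι) ≡ just e × Dep F (i ∸ 1) e i'
  DataDep F i i' = Σ Instr λ ι → Σ Expr λ e →
    at F i ≡ just ι × valExpr (Instr.cmd ι) ≡ just e × Dep F (i ∸ 1) e i'
  CtrlDep F i i' = i' < i × IsAssumeAt F i'

  seqV : ∀ {k} → Vec Val k → Maybe (Vec D k)
  seqV [] = just []
  seqV (nothing ∷ _) = nothing
  seqV (just d ∷ vs) with seqV vs
  ... | nothing = nothing
  ... | just ds = just (d ∷ ds)

  liftF : ∀ {k} → (Vec D k → D) → Vec Val k → Val
  liftF f vs with seqV vs
  ... | nothing = nothing
  ... | just ds = just (f ds)

  data AV : Set where
    top : AV
    bot : AV
    val : D → AV

  liftV : Val → AV
  liftV nothing  = bot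
  liftV (just d) = val d

  module _ {n : ℕ} where

    Fs : State n → Fin n → List Instr
    Fs s t = TState.F (State.R s t)

    Cs : State n → Fin n → ℕ → Bool
    Cs s t = TState.C (State.R s t)

    Ls : State n → Fin n → ℕ → Maybe (Src n)
    Ls s t = TState.L (State.R s t)

    coS : State n → Src n → Maybe ℚ
    coS s (init _) = just 0ℚ
    coS s (st t i) = State.co s t i

    coL : State n → Fin n → ℕ → Maybe ℚ
    coL s t i with Ls s t i
    ... | nothing  = nothing
    ... | just src = coS s src

    KeyLt : Maybe ℚ → Maybe ℚ → Set
    KeyLt (just k) (just k') = k ℚ.< k'
    KeyLt _        _         = ⊥

    KeyLe : Maybe ℚ → Maybe ℚ → Set
    KeyLe (just k) (just k') = k ℚ.≤ k'
    KeyLe _        _         = ⊥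

    mutual
      -- RegV s t j r v : the value of register r seen by an instruction of
      -- thread t whose earlier instructions are those at indices 1..j
      data RegV (s : State n) (t : Fin n) : ℕ → Reg → Val → Set where
        rv-none   : ∀ {r} → RegV s t zero r (just 0D)
        rv-skip   : ∀ {j r v} → definesAt (Fs s t) (suc j) r ≡ false →
                    RegV s t j r v → RegV s t (suc j) r v
        rv-assign : ∀ {j r ι e v} → at (Fs s t) (suc j) ≡ just ι →
                    Instr.cmd ι ≡ assign r e → EvalE s t j e v → RegV s t (suc j) r v
        rv-load⊥  : ∀ {j r ι e} → at (Fs s t) (suc j) ≡ just ι →
                    Instr.cmd ι ≡ load r e → Ls s t (suc j) ≡ nothing →
                    RegV s t (suc j) r nothing
        rv-loadI  : ∀ {j r ι e a} → at (Fs s t) (suc j) ≡ just ι →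
                    Instr.cmd ι ≡ load r e → Ls s t (suc j) ≡ just (init a) →
                    RegV s t (suc j) r (just 0D)
        rv-loadS  : ∀ {j r ι e t' i' ι' ea ev v} → at (Fs s t) (suc j) ≡ just ι →
                    Instr.cmd ι ≡ load r e → Ls s t (suc j) ≡ just (st t' i') →
                    at (Fs s t') i' ≡ just ι' → Instr.cmd ι' ≡ store ea ev →
                    EvalE s t' (i' ∸ 1) ev v → RegV s t (suc j) r v

      data EvalE (s : State n) (t : Fin n) : ℕ → Expr → Val → Set where
        ev-const : ∀ {j d} → EvalE s t j (const d) (just d)
        ev-reg   : ∀ {j r v} → RegV s t j r v → EvalE s t j (reg r) v
        ev-fun   : ∀ {j k} {f : Vec D k → D} {es vs} → EvalArgs s t j es vs →
                   EvalE s t j (fun f es) (liftF f vs)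

      data EvalArgs (s : State n) (t : Fin n) (j : ℕ) : ∀ {k} → Vec Expr k → Vec Val k → Set where
        ea-nil  : EvalArgs s t j [] []
        ea-cons : ∀ {k e v} {es : Vec Expr k} {vs} → EvalE s t j e v →
                  EvalArgs s t j es vs → EvalArgs s t j (e ∷ es) (v ∷ vs)

    data GetAddr (s : State n) (t : Fin n) (i : ℕ) : AV → Set where
      ga-expr : ∀ {ι e v} → at (Fs s t) i ≡ just ι → addrExpr (Instr.cmd ι) ≡ just e →
                EvalE s t (i ∸ 1) e v → GetAddr s t i (liftV v)
      ga-top  : ∀ {ι} → at (Fs s t) i ≡ just ι → addrExpr (Instr.cmd ι) ≡ nothing →
                GetAddr s t i top

    data GetValue (s : State n) (t : Fin n) (i : ℕ) : AV → Set where
      gv-expr : ∀ {ι e v} → at (Fs s t) i ≡ just ι → valExpr (Instr.cmd ι) ≡ just e →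
                EvalE s t (i ∸ 1) e v → GetValue s t i (liftV v)
      gv-top  : ∀ {ι} → at (Fs s t) i ≡ just ι → valExpr (Instr.cmd ι) ≡ nothing →
                GetValue s t i top

    updT : State n → Fin n → TState n → State n
    updT s t ts = record s { R = updFin (State.R s) t ts }

    appendF : State n → Fin n → Instr → State n
    appendF s t ι = updT s t (record (State.R s t) { F = Fs s t ∷ʳ ι })

    setC : State n → Fin n → ℕ → State n
    setC s t i = updT s t (record (State.R s t) { C = updℕ (Cs s t) i true })

    setL : State n → Fin n → ℕ → Src n → State n
    setL s t i x = updT s t (record (State.R s t) { L = updℕ (Ls s t) i (just x) })

    setCo : State n → Fin n → ℕ → ℚ → State n
    setCo s t i k = record s { co = updFin (State.co s) t (updℕ (State.co s t) i (just k)) }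

    setProp : State n → Fin n → D → Src n → State n
    setProp s t a x = record s { prop = updFin (State.prop s) t (updFin (State.prop s t) a x) }

    ctrl : ℕ → List Instr → ℕ
    ctrl q []       = q
    ctrl q (ι ∷ ιs) = ctrl (Instr.tgt ι) ιs

    data Label : Set where
      fetch   : Fin n → Instr → Label
      ld      : Fin n → ℕ → D → Label
      commit  : Fin n → ℕ → Label
      commitS : Fin n → ℕ → ℚ → D → Label
      prop    : Fin n → Fin n → ℕ → D → Label

    record CommitPre (s : State n) (t : Fin n) (i : ℕ) : Set where
      field
        notC     : Cs s t i ≡ false
        deps     : ∀ i' → AddrDep (Fs s t) i i' ⊎ DataDep (Fs s t) i i' ⊎ CtrlDep (Fs s t) i i' →
                   Cs s t i' ≡ true
        addrOk   : Σ AV λ x → GetAddr s t i x × x ≢ bot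
        valueOk  : Σ AV λ x → GetValue s t i x × x ≢ bot
        order    : ∀ a → GetAddr s t i (val a) → ∀ i' → i' < i →
                   GetAddr s t i' (val a) ⊎ GetAddr s t i' bot → Cs s t i' ≡ true
        loadOk   : IsLoadAt (Fs s t) i → Ls s t i ≢ nothing
        assumeOk : IsAssumeAt (Fs s t) i → ¬ GetValue s t i (val 0D)

    record EarlyPre (s : State n) (t : Fin n) (i i' : ℕ) (a : D) : Set where
      field
        isLoad   : IsLoadAt (Fs s t) i
        unread   : Ls s t i ≡ nothing
        addr     : GetAddr s t i (val a)
        before   : i' < i
        isStore  : IsStoreAt (Fs s t) i'
        addr'    : GetAddr s t i' (val a)
        value'   : Σ AV λ x → GetValue s t i' x × x ≢ bot
        notC'    : Cs s t i' ≡ false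
        greatest : ∀ j → i' < j → j < i → IsStoreAt (Fs s t) j →
                   ¬ (GetAddr s t j (val a) ⊎ GetAddr s t j bot)

    data Step (P : Program n) (s : State n) : Label → State n → Set where
      s-fetch  : ∀ {t ι} → ι ∈ Thread.instrs (lookup P t) →
                 Instr.src ι ≡ ctrl (Thread.q0 (lookup P t)) (Fs s t) →
                 Step P s (fetch t ι) (appendF s t ι)
      s-load   : ∀ {t i a} → IsLoadAt (Fs s t) i → Ls s t i ≡ nothing →
                 GetAddr s t i (val a) →
                 Step P s (ld t i a) (setL s t i (State.prop s t a))
      s-early  : ∀ {t i i' a} → EarlyPre s t i i' a →
                 Step P s (ld t i a) (setL s t i (st t i'))
      s-commit : ∀ {t i} → ¬ IsStoreAt (Fs s t) i → CommitPre s t i →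
                 Step P s (commit t i) (setC s t i)
      -- STORE, together with the immediate propagation to thread t
      s-store  : ∀ {t i k a} → IsStoreAt (Fs s t) i → CommitPre s t i →
                 GetAddr s t i (val a) →
                 k ≢ 0ℚ → (∀ t' i' → State.co s t' i' ≢ just k) →
                 KeyLt (coS s (State.prop s t a)) (just k) →
                 Step P s (commitS t i k a)
                   (setProp (setCo (setC s t i) t i k) t a (st t i))
      s-prop   : ∀ {t t' i' a} → Cs s t' i' ≡ true → IsStoreAt (Fs s t') i' →
                 GetAddr s t' i' (val a) →
                 KeyLt (coS s (State.prop s t a)) (State.co s t' i') →
                 Step P s (prop t t' i' a) (setProp s t a (st t' i'))

    initState : State n
    initState = record
      { R    = λ _ → record { F = [] ; C = λ _ → false ; L = λ _ → nothing }
      ; co   = λ _ _ → nothing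
      ; prop = λ _ a → init a
      }

    record Final (s : State n) : Set where
      field
        allCommitted : ∀ t i → 1 ≤ i → i ≤ length (Fs s t) → Cs s t i ≡ true
        loadLoad     : ∀ t i' i a → i' < i → IsLoadAt (Fs s t) i' → IsLoadAt (Fs s t) i →
                       GetAddr s t i' (val a) → GetAddr s t i (val a) →
                       KeyLe (coL s t i') (coL s t i)
        storeLoad    : ∀ t i' i a → i' < i → IsStoreAt (Fs s t) i' → IsLoadAt (Fs s t) i →
                       GetAddr s t i' (val a) → GetAddr s t i (val a) →
                       KeyLe (State.co s t i') (coL s t i)

    data Run (P : Program n) : State n → List Label → State n → Set where
      done : ∀ {s} → Run P s [] s
      step : ∀ {s l s' σ s''} → Step P s l s' → Run P s' σ s'' → Run P s (l ∷ σ) s''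

    data EarlyIn {P : Program n} : ∀ {s σ s'} → Run P s σ s' → Fin n → ℕ → ℕ → Set where
      here  : ∀ {s σ s'' t i i' a} {pre : EarlyPre s t i i' a}
                {ρ : Run P (setL s t i (st t i')) σ s''} →
              EarlyIn (step {s = s} (s-early pre) ρ) t i i'
      there : ∀ {s l s' σ s'' t i i'} {stp : Step P s l s'} {ρ : Run P s' σ s''} →
              EarlyIn ρ t i i' → EarlyIn (step stp ρ) t i i'

    CPower : Program n → List Label → Set
    CPower P σ = Σ (State n) λ sf → Run P initState σ sf × Final sf

-- Along a run the state only grows: fetched sequences are extended, and load sources,
-- commits and coherence keys persist, while the key of the store propagated to a thread
-- never decreases.  Hence an address evaluated to a value stays that value, and an address
-- seen later was that value or ⊥ earlier.  If EARLY lets (t,i) read (t,i'), finality forces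
-- (t,i') to commit later, and a later commit of a store j with i' < j < i to the same address
-- would contradict the maximality of i' in the EARLY premise.  Conversely, take the ld event
-- preceding the commit of (t,i').  It is not a LOAD: (t,i') would then get a key above that of
-- the store read by (t,i), breaking store-load coherence of the final state.  If it is an EARLY
-- from (t,i''), then i'' < i' contradicts maximality, and i'' > i' forces (t,i'') to commit
-- after (t,i'), since same-address stores commit in program order, i.e. inside σ₃.

module Submission where

open import Defs hiding (trans)
open import Data.Bool using (Bool; true; false; if_then_else_)
open import Data.Bool.Properties using (if-float)
open import Data.Empty using (⊥; ⊥-elim)
open import Data.Fin as Fin using (Fin)
open import Data.List using (List; []; _∷_; _++_; length)
open import Data.List.Properties using (++-identityʳ; ++-assoc)
open import Data.List.Membership.Propositional using (_∈_; _∉_)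
open import Data.List.Membership.Propositional.Properties using (∈-++⁺ʳ; ∈-++⁻; ∈-∃++)
import Data.List.Relation.Unary.Any as Any
open import Data.Maybe as Maybe using (Maybe; just; nothing; maybe′)
open import Data.Nat as ℕ using (ℕ; zero; suc; _∸_; _<_; _≤_; z≤n; s≤s)
open import Data.Nat.Properties using (≤-trans; <⇒≤; m∸n≤m; <-cmp; <-irrefl)
open import Data.Product using (Σ; _×_; _,_; proj₁; proj₂)
open import Data.Rational as ℚ using (ℚ)
import Data.Rational.Properties as ℚ
open import Data.Sum using (_⊎_; inj₁; inj₂; [_,_])
open import Data.Unit using (⊤; tt)
open import Data.Vec using (Vec; []; _∷_)
open import Data.Vec.Relation.Binary.Pointwise.Inductive using (Pointwise; []; _∷_)
open import Function using (_∘_; id)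
open import Relation.Binary.Definitions using (DecidableEquality; tri<; tri≈; tri>)
open import Relation.Binary.PropositionalEquality
  using (_≡_; _≢_; refl; sym; trans; cong; cong₂; subst; subst₂)
open import Relation.Nullary using (yes; no)
open import Relation.Nullary.Decidable using (isYes)

at-bounds : ∀ {A : Set} (xs : List A) i {x} → at xs i ≡ just x → 1 ≤ i × i ≤ length xs
at-bounds (_ ∷ _)  (suc zero)    _  = s≤s z≤n , s≤s z≤n
at-bounds (_ ∷ xs) (suc (suc i)) eq = s≤s z≤n , s≤s (proj₂ (at-bounds xs (suc i) eq))

at-++ˡ : ∀ {A : Set} (xs ys : List A) i → i ≤ length xs → at (xs ++ ys) i ≡ at xs i
at-++ˡ xs       ys zero          _         = refl
at-++ˡ (_ ∷ _)  ys (suc zero)    _         = refl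
at-++ˡ (_ ∷ xs) ys (suc (suc i)) (s≤s i≤) = at-++ˡ xs ys (suc i) i≤

unchanged-prefix : ∀ {A : Set} {xs ys : List A} → ys ≡ xs → Σ (List A) λ ext → ys ≡ xs ++ ext
unchanged-prefix eq = [] , trans eq (sym (++-identityʳ _))

at⇒pred≤length : ∀ {A : Set} (xs : List A) i {x} → at xs i ≡ just x → i ∸ 1 ≤ length xs
at⇒pred≤length xs i eq = ≤-trans (m∸n≤m i 1) (proj₂ (at-bounds xs i eq))

isYes-≟-refl : ∀ {I : Set} (_≟_ : DecidableEquality I) i → isYes (i ≟ i) ≡ true
isYes-≟-refl _≟_ i with i ≟ i
... | yes _   = refl
... | no i≢i = ⊥-elim (i≢i refl)

-- updFin and updℕ of Defs are definitionally update Fin._≟_ and update ℕ._≟_.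
update : ∀ {I A : Set} → DecidableEquality I → (I → A) → I → A → I → A
update _≟_ f i x j = if isYes (j ≟ i) then x else f j

module _ {I A : Set} (_≟_ : DecidableEquality I) (f : I → A) (i : I) where

  update-same : ∀ x → update _≟_ f i x i ≡ x
  update-same x = cong (if_then x else f i) (isYes-≟-refl _≟_ i)

  update-other : ∀ x {j} → j ≢ i → update _≟_ f i x j ≡ f j
  update-other x {j} j≢i with j ≟ i
  ... | yes j≡i = ⊥-elim (j≢i j≡i)
  ... | no _    = refl

  update-self : ∀ j → update _≟_ f i (f i) j ≡ f j
  update-self j with j ≟ i
  ... | yes refl = refl
  ... | no _     = refl

  update-map : ∀ {B : Set} (g : A → B) x j → g (update _≟_ f i x j) ≡ update _≟_ (g ∘ f) i (g x) j
  update-map g x j = if-float g (isYes (j ≟ i))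

module _ {I J A : Set} (_≟ᴵ_ : DecidableEquality I) (_≟ᴶ_ : DecidableEquality J)
         (f : I → J → A) (i : I) (j : J) (x : A) where

  update₂-same : update _≟ᴵ_ f i (update _≟ᴶ_ (f i) j x) i j ≡ x
  update₂-same = trans (cong (λ g → g j) (update-same _≟ᴵ_ f i _)) (update-same _≟ᴶ_ (f i) j x)

  update₂-other : ∀ {i' j'} → i' ≢ i ⊎ j' ≢ j →
                  update _≟ᴵ_ f i (update _≟ᴶ_ (f i) j x) i' j' ≡ f i' j'
  update₂-other {i'} {j'} (inj₁ i'≢i) = cong (λ g → g j') (update-other _≟ᴵ_ f i _ i'≢i)
  update₂-other {i'} {j'} (inj₂ j'≢j) with i' ≟ᴵ i
  ... | yes refl = update-other _≟ᴶ_ (f i) j x j'≢j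
  ... | no _     = refl

decide-pair : ∀ {I J : Set} → DecidableEquality I → DecidableEquality J →
              ∀ (i i' : I) (j j' : J) → (i ≡ i' × j ≡ j') ⊎ (i ≢ i' ⊎ j ≢ j')
decide-pair _≟ᴵ_ _≟ᴶ_ i i' j j' with i ≟ᴵ i' | j ≟ᴶ j'
... | yes i≡ | yes j≡ = inj₁ (i≡ , j≡)
... | no i≢  | _      = inj₂ (inj₁ i≢)
... | yes _  | no j≢  = inj₂ (inj₂ j≢)

false≢true : false ≢ true
false≢true ()

no-flip : ∀ {A : Set} {b b' : Bool} → b' ≡ b → b ≡ false → b' ≡ true → A
no-flip refl refl ()

_≼_ : ∀ {A : Set} → Maybe A → Maybe A → Set
x ≼ y = x ≡ nothing ⊎ x ≡ y

map-≼ : ∀ {A B : Set} (f : A → B) {x y} → x ≼ y → Maybe.map f x ≼ Maybe.map f y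
map-≼ f (inj₁ refl) = inj₁ refl
map-≼ f (inj₂ refl) = inj₂ refl

module _ {nD nR : ℕ} where

  definesAt-at : ∀ (F : List (Instr {nD} {nR})) i r →
                 definesAt F i r ≡ maybe′ (definesReg r ∘ Instr.cmd) false (at F i)
  definesAt-at F i r with at F i
  ... | nothing = refl
  ... | just _  = refl

  definesAt-cong : ∀ (F G : List (Instr {nD} {nR})) i j r → at F i ≡ at G j →
                   definesAt F i r ≡ definesAt G j r
  definesAt-cong F G i j r eq =
    trans (definesAt-at F i r) (trans (cong (maybe′ _ false) eq) (sym (definesAt-at G j r)))

  skip-clash : ∀ {A : Set} (F : List (Instr {nD} {nR})) i r {ι c} → definesAt F i r ≡ false →
               at F i ≡ just ι → Instr.cmd ι ≡ c → definesReg r c ≡ true → A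
  skip-clash F i r d at≡ refl def =
    ⊥-elim (false≢true (trans (sym d) (trans (definesAt-at F i r) (trans (cong (maybe′ _ false) at≡) def))))

  same-cmd : ∀ {m : Maybe (Instr {nD} {nR})} {ι ι' c c'} →
             m ≡ just ι → m ≡ just ι' → Instr.cmd ι ≡ c → Instr.cmd ι' ≡ c' → c ≡ c'
  same-cmd at≡ at≡' refl refl with trans (sym at≡) at≡'
  ... | refl = refl

  liftF-map : ∀ {k} (f : Vec (D {nD} {nR}) k → D {nD} {nR}) vs →
              liftF {nD} {nR} f vs ≡ Maybe.map f (seqV {nD} {nR} vs)
  liftF-map f vs with seqV {nD} {nR} vs
  ... | nothing = refl
  ... | just _  = refl

  seqV-defined-∷ : ∀ {k} {v : Val {nD} {nR}} {vs : Vec (Val {nD} {nR}) k} →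
                   seqV {nD} {nR} (v ∷ vs) ≢ nothing → v ≢ nothing × seqV {nD} {nR} vs ≢ nothing
  seqV-defined-∷ {v = nothing} def = ⊥-elim (def refl)
  seqV-defined-∷ {v = just _} {vs} def with seqV {nD} {nR} vs
  ... | nothing = ⊥-elim (def refl)
  ... | just _  = (λ ()) , (λ ())

  liftF-defined : ∀ {k} (f : Vec (D {nD} {nR}) k → D {nD} {nR}) vs →
                  liftF {nD} {nR} f vs ≢ nothing → seqV {nD} {nR} vs ≢ nothing
  liftF-defined f vs def undef rewrite liftF-map f vs | undef = def refl

  seqV-≼ : ∀ {k} {vs ws : Vec (Val {nD} {nR}) k} → Pointwise _≼_ vs ws →
           seqV {nD} {nR} vs ≼ seqV {nD} {nR} ws
  seqV-≼ [] = inj₂ refl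
  seqV-≼ (inj₁ refl ∷ _) = inj₁ refl
  seqV-≼ {vs = nothing ∷ _} (inj₂ refl ∷ _) = inj₁ refl
  seqV-≼ {vs = just _ ∷ vs} {just _ ∷ ws} (inj₂ refl ∷ ps)
    with seqV {nD} {nR} vs | seqV {nD} {nR} ws | seqV-≼ ps
  ... | nothing | _ | _ = inj₁ refl
  ... | just _  | _ | inj₂ refl = inj₂ refl

  liftF-≼ : ∀ {k} (f : Vec (D {nD} {nR}) k → D {nD} {nR}) {vs ws} → Pointwise _≼_ vs ws →
            liftF {nD} {nR} f vs ≼ liftF {nD} {nR} f ws
  liftF-≼ f {vs} {ws} ps rewrite liftF-map f vs | liftF-map f ws = map-≼ f (seqV-≼ ps)

  val-injective : ∀ {a b : D {nD} {nR}} → val {nD} {nR} a ≡ val b → a ≡ b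
  val-injective refl = refl

  val≢bot : ∀ {a : D {nD} {nR}} → val {nD} {nR} a ≢ bot
  val≢bot ()

module _ {nD nR n : ℕ} where

  private
    St = State {nD} {nR} n
    Source = Src {nD} {nR} n
    Lab = Label {nD} {nR} {n}

  updT-unchanged : ∀ {A : Set} (g : TState {nD} {nR} n → A) (s : St) t ts →
                   g ts ≡ g (State.R s t) → ∀ t' → g (State.R (updT s t ts) t') ≡ g (State.R s t')
  updT-unchanged g s t ts eq t' =
    trans (update-map Fin._≟_ (State.R s) t g ts t')
          (trans (cong (λ y → update Fin._≟_ (g ∘ State.R s) t y t') eq)
                 (update-self Fin._≟_ (g ∘ State.R s) t t'))

  module _ (s : St) (t : Fin n) where

    Fs-setC : ∀ i t' → Fs (setC s t i) t' ≡ Fs s t'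
    Fs-setC i = updT-unchanged TState.F s t _ refl

    Fs-setL : ∀ i x t' → Fs (setL s t i x) t' ≡ Fs s t'
    Fs-setL i x = updT-unchanged TState.F s t _ refl

    Cs-setL : ∀ i x t' m → Cs (setL s t i x) t' m ≡ Cs s t' m
    Cs-setL i x t' m = updT-unchanged (λ ts → TState.C ts m) s t _ refl t'

    Cs-appendF : ∀ ι t' m → Cs (appendF s t ι) t' m ≡ Cs s t' m
    Cs-appendF ι t' m = updT-unchanged (λ ts → TState.C ts m) s t _ refl t'

    Ls-setC : ∀ i t' m → Ls (setC s t i) t' m ≡ Ls s t' m
    Ls-setC i t' m = updT-unchanged (λ ts → TState.L ts m) s t _ refl t'

    Ls-appendF : ∀ ι t' m → Ls (appendF s t ι) t' m ≡ Ls s t' m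
    Ls-appendF ι t' m = updT-unchanged (λ ts → TState.L ts m) s t _ refl t'

    Fs-appendF : ∀ ι t' → Σ (List (Instr {nD} {nR})) λ ext → Fs (appendF s t ι) t' ≡ Fs s t' ++ ext
    Fs-appendF ι t' with t' Fin.≟ t
    ... | yes refl = ι ∷ [] , refl
    ... | no _     = unchanged-prefix refl

    Cs-setC-same : ∀ i → Cs (setC s t i) t i ≡ true
    Cs-setC-same i = trans (cong (λ g → g i) (update-map Fin._≟_ (State.R s) t TState.C _ t))
                           (update₂-same Fin._≟_ ℕ._≟_ (Cs s) t i true)

    Cs-setC-other : ∀ i {t' m} → t' ≢ t ⊎ m ≢ i → Cs (setC s t i) t' m ≡ Cs s t' m
    Cs-setC-other i {t'} {m} ne = trans (cong (λ g → g m) (update-map Fin._≟_ (State.R s) t TState.C _ t'))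
                                        (update₂-other Fin._≟_ ℕ._≟_ (Cs s) t i true ne)

    Ls-setL-same : ∀ i x → Ls (setL s t i x) t i ≡ just x
    Ls-setL-same i x = trans (cong (λ g → g i) (update-map Fin._≟_ (State.R s) t TState.L _ t))
                             (update₂-same Fin._≟_ ℕ._≟_ (Ls s) t i (just x))

    Ls-setL-other : ∀ i x {t' m} → t' ≢ t ⊎ m ≢ i → Ls (setL s t i x) t' m ≡ Ls s t' m
    Ls-setL-other i x {t'} {m} ne = trans (cong (λ g → g m) (update-map Fin._≟_ (State.R s) t TState.L _ t'))
                                          (update₂-other Fin._≟_ ℕ._≟_ (Ls s) t i (just x) ne)

    co-setCo-same : ∀ i k → State.co (setCo s t i k) t i ≡ just k
    co-setCo-same i k = update₂-same Fin._≟_ ℕ._≟_ (State.co s) t i (just k)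

    co-setCo-other : ∀ i k {t' m} → t' ≢ t ⊎ m ≢ i → State.co (setCo s t i k) t' m ≡ State.co s t' m
    co-setCo-other i k = update₂-other Fin._≟_ ℕ._≟_ (State.co s) t i (just k)

    prop-setProp-same : ∀ a x → State.prop (setProp s t a x) t a ≡ x
    prop-setProp-same a x = update₂-same Fin._≟_ Fin._≟_ (State.prop s) t a x

    prop-setProp-other : ∀ a x {t' a'} → t' ≢ t ⊎ a' ≢ a →
                         State.prop (setProp s t a x) t' a' ≡ State.prop s t' a'
    prop-setProp-other a x = update₂-other Fin._≟_ Fin._≟_ (State.prop s) t a x

  -- Extension of states

  record _⊑_ (s s' : St) : Set where
    field
      F-prefix      : ∀ t → Σ (List (Instr {nD} {nR})) λ ext → Fs s' t ≡ Fs s t ++ ext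
      L-kept        : ∀ {t m src} → Ls s t m ≡ just src → Ls s' t m ≡ just src
      C-kept        : ∀ {t m} → Cs s t m ≡ true → Cs s' t m ≡ true
      co-kept       : ∀ {t m k} → State.co s t m ≡ just k → State.co s' t m ≡ just k
      prop-key-mono : ∀ {t a x} → coS s (State.prop s t a) ≡ just x →
                      Σ ℚ λ y → coS s' (State.prop s' t a) ≡ just y × x ℚ.≤ y
  open _⊑_

  coS-kept : ∀ {s s' : St} → (∀ {t m k} → State.co s t m ≡ just k → State.co s' t m ≡ just k) →
             ∀ src {x} → coS s src ≡ just x → coS s' src ≡ just x
  coS-kept kept (init _) eq = eq
  coS-kept kept (st _ _) eq = kept eq

  prop-key-kept : ∀ {s s' : St} → (∀ {t m k} → State.co s t m ≡ just k → State.co s' t m ≡ just k) →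
                  (∀ t a → State.prop s' t a ≡ State.prop s t a) →
                  ∀ {t a x} → coS s (State.prop s t a) ≡ just x →
                  Σ ℚ λ y → coS s' (State.prop s' t a) ≡ just y × x ℚ.≤ y
  prop-key-kept {s} {s'} kept same {t} {a} {x} eq =
    x , trans (cong (coS s') (same t a)) (coS-kept {s} {s'} kept (State.prop s t a) eq) , ℚ.≤-refl

  ⊑-refl : ∀ {s} → s ⊑ s
  ⊑-refl {s} = record
    { F-prefix      = λ _ → unchanged-prefix refl
    ; L-kept        = id
    ; C-kept        = id
    ; co-kept       = id
    ; prop-key-mono = prop-key-kept {s} {s} id (λ _ _ → refl)
    }

  ⊑-trans : ∀ {s₁ s₂ s₃} → s₁ ⊑ s₂ → s₂ ⊑ s₃ → s₁ ⊑ s₃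
  ⊑-trans {s₁} E₁ E₂ = record
    { F-prefix      = λ t → let (ext₁ , eq₁) = F-prefix E₁ t ; (ext₂ , eq₂) = F-prefix E₂ t in
                      ext₁ ++ ext₂ , trans eq₂ (trans (cong (_++ ext₂) eq₁) (++-assoc (Fs s₁ t) ext₁ ext₂))
    ; L-kept        = L-kept E₂ ∘ L-kept E₁
    ; C-kept        = C-kept E₂ ∘ C-kept E₁
    ; co-kept       = co-kept E₂ ∘ co-kept E₁
    ; prop-key-mono = λ eq → let (y , eq₁ , x≤y) = prop-key-mono E₁ eq
                                 (z , eq₂ , y≤z) = prop-key-mono E₂ eq₁
                             in z , eq₂ , ℚ.≤-trans x≤y y≤z
    }

  at-⊑-≤ : ∀ {s s'} → s ⊑ s' → ∀ t m → m ≤ length (Fs s t) → at (Fs s' t) m ≡ at (Fs s t) m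
  at-⊑-≤ {s} E t m m≤ with F-prefix E t
  ... | ext , eq rewrite eq = at-++ˡ (Fs s t) ext m m≤

  at-⊑ : ∀ {s s'} → s ⊑ s' → ∀ t m {ι} → at (Fs s t) m ≡ just ι → at (Fs s' t) m ≡ just ι
  at-⊑ {s} E t m eq = trans (at-⊑-≤ E t m (proj₂ (at-bounds (Fs s t) m eq))) eq

  definesAt-⊑ : ∀ {s s'} → s ⊑ s' → ∀ {t m} r → m ≤ length (Fs s t) →
                definesAt (Fs s' t) m r ≡ definesAt (Fs s t) m r
  definesAt-⊑ {s} {s'} E {t} {m} r m≤ = definesAt-cong (Fs s' t) (Fs s t) m m r (at-⊑-≤ E t m m≤)

  IsStoreAt-⊑ : ∀ {s s'} → s ⊑ s' → ∀ t m → IsStoreAt (Fs s t) m → IsStoreAt (Fs s' t) m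
  IsStoreAt-⊑ E t m (ι , eq , isS) = ι , at-⊑ E t m eq , isS

  IsStoreAt-⊑⁻ : ∀ {s s'} → s ⊑ s' → ∀ t m → m ≤ length (Fs s t) →
                 IsStoreAt (Fs s' t) m → IsStoreAt (Fs s t) m
  IsStoreAt-⊑⁻ E t m m≤ (ι , eq , isS) = ι , trans (sym (at-⊑-≤ E t m m≤)) eq , isS

  Ls-⊑⁻ : ∀ {s s'} → s ⊑ s' → ∀ t m → Ls s t m ≡ nothing ⊎ Ls s t m ≡ Ls s' t m
  Ls-⊑⁻ {s} E t m with Ls s t m in eq
  ... | nothing  = inj₁ refl
  ... | just src = inj₂ (sym (L-kept E eq))

  Fetched : St → Source → Set
  Fetched s (init _) = ⊤
  Fetched s (st t i) = Σ (Instr {nD} {nR}) λ ι → at (Fs s t) i ≡ just ι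

  Fetched-⊑ : ∀ {s s'} → s ⊑ s' → ∀ src → Fetched s src → Fetched s' src
  Fetched-⊑ E (init _) _        = tt
  Fetched-⊑ E (st t i) (ι , eq) = ι , at-⊑ E t i eq

  record WellFormed (s : St) : Set where
    field
      read-fetched    : ∀ {t m src} → Ls s t m ≡ just src → Fetched s src
      prop-fetched    : ∀ t a → Fetched s (State.prop s t a)
      prop-keyed      : ∀ t a → Σ ℚ λ x → coS s (State.prop s t a) ≡ just x
      keyed-committed : ∀ {t m k} → State.co s t m ≡ just k → Cs s t m ≡ true
  open WellFormed

  initState-wf : WellFormed initState
  initState-wf = record
    { read-fetched    = λ ()
    ; prop-fetched    = λ _ _ → tt
    ; prop-keyed      = λ _ _ → ℚ.0ℚ , refl
    ; keyed-committed = λ ()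
    }

  uncommitted-unkeyed : ∀ {s} → WellFormed s → ∀ {t i} → Cs s t i ≡ false → State.co s t i ≡ nothing
  uncommitted-unkeyed {s} wf {t} {i} c≡f with State.co s t i in eq
  ... | nothing = refl
  ... | just _  = ⊥-elim (false≢true (trans (sym c≡f) (keyed-committed wf eq)))

  WellFormed-⊑ : ∀ {s s'} → WellFormed s → s ⊑ s' →
    (∀ {t m src} → Ls s' t m ≡ just src → Ls s t m ≡ just src ⊎ Fetched s' src) →
    (∀ t a → State.prop s' t a ≡ State.prop s t a ⊎ Fetched s' (State.prop s' t a)) →
    (∀ {t m k} → State.co s' t m ≡ just k → State.co s t m ≡ just k ⊎ Cs s' t m ≡ true) →
    WellFormed s'
  WellFormed-⊑ {s} wf E new-read new-prop new-key = record
    { read-fetched    = λ {_} {_} {src} eq → [ Fetched-⊑ E src ∘ read-fetched wf , id ] (new-read eq)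
    ; prop-fetched    = λ t a → [ (λ eq → subst (Fetched _) (sym eq) (Fetched-⊑ E _ (prop-fetched wf t a))) , id ]
                                  (new-prop t a)
    ; prop-keyed      = λ t a → let (y , eq , _) = prop-key-mono E (proj₂ (prop-keyed wf t a)) in y , eq
    ; keyed-committed = λ eq → [ C-kept E ∘ keyed-committed wf , id ] (new-key eq)
    }

  mutual
    RegV-⊑ : ∀ {s s'} → s ⊑ s' → ∀ {t j r v} → j ≤ length (Fs s t) → v ≢ nothing →
             RegV s t j r v → RegV s' t j r v
    RegV-⊑ E j≤ v↓ rv-none = rv-none
    RegV-⊑ E j≤ v↓ (rv-skip {r = r} d rv) =
      rv-skip (trans (definesAt-⊑ E r j≤) d) (RegV-⊑ E (<⇒≤ j≤) v↓ rv)
    RegV-⊑ E {t} {suc j} j≤ v↓ (rv-assign at≡ c ev) =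
      rv-assign (at-⊑ E t (suc j) at≡) c (EvalE-⊑ E (<⇒≤ j≤) v↓ ev)
    RegV-⊑ E j≤ v↓ (rv-load⊥ _ _ _) = ⊥-elim (v↓ refl)
    RegV-⊑ E {t} {suc j} j≤ v↓ (rv-loadI at≡ c l) = rv-loadI (at-⊑ E t (suc j) at≡) c (L-kept E l)
    RegV-⊑ {s} E {t} {suc j} j≤ v↓ (rv-loadS {t' = t'} {i'} at≡ c l at≡' c' ev) =
      rv-loadS (at-⊑ E t (suc j) at≡) c (L-kept E l) (at-⊑ E t' i' at≡') c'
               (EvalE-⊑ E (at⇒pred≤length (Fs s t') i' at≡') v↓ ev)

    EvalE-⊑ : ∀ {s s'} → s ⊑ s' → ∀ {t j e v} → j ≤ length (Fs s t) → v ≢ nothing →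
              EvalE s t j e v → EvalE s' t j e v
    EvalE-⊑ E j≤ v↓ ev-const = ev-const
    EvalE-⊑ E j≤ v↓ (ev-reg rv) = ev-reg (RegV-⊑ E j≤ v↓ rv)
    EvalE-⊑ E j≤ v↓ (ev-fun {f = f} {vs = vs} args) = ev-fun (EvalArgs-⊑ E j≤ (liftF-defined f vs v↓) args)

    EvalArgs-⊑ : ∀ {s s'} → s ⊑ s' → ∀ {t j k} {es : Vec (Expr {nD} {nR}) k} {vs} → j ≤ length (Fs s t) →
                 seqV {nD} {nR} vs ≢ nothing → EvalArgs s t j es vs → EvalArgs s' t j es vs
    EvalArgs-⊑ E j≤ vs↓ ea-nil = ea-nil
    EvalArgs-⊑ E j≤ vs↓ (ea-cons ev args) =
      let (v↓ , vs↓′) = seqV-defined-∷ vs↓ in ea-cons (EvalE-⊑ E j≤ v↓ ev) (EvalArgs-⊑ E j≤ vs↓′ args)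

  mutual
    RegV-⊑⁻ : ∀ {s s'} → WellFormed s → s ⊑ s' → ∀ {t j r w} → j ≤ length (Fs s t) → RegV s' t j r w →
              Σ (Val {nD} {nR}) λ v → RegV s t j r v × v ≼ w
    RegV-⊑⁻ wf E j≤ rv-none = _ , rv-none , inj₂ refl
    RegV-⊑⁻ wf E j≤ (rv-skip {r = r} d rv) =
      let (v , rv₀ , v≼) = RegV-⊑⁻ wf E (<⇒≤ j≤) rv
      in v , rv-skip (trans (sym (definesAt-⊑ E r j≤)) d) rv₀ , v≼
    RegV-⊑⁻ wf E {t} {suc j} j≤ (rv-assign at≡ c ev) =
      let (v , ev₀ , v≼) = EvalE-⊑⁻ wf E (<⇒≤ j≤) ev
      in v , rv-assign (trans (sym (at-⊑-≤ E t (suc j) j≤)) at≡) c ev₀ , v≼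
    RegV-⊑⁻ wf E {t} {suc j} j≤ (rv-load⊥ at≡ c l) with Ls-⊑⁻ E t (suc j)
    ... | inj₁ l₀ = _ , rv-load⊥ (trans (sym (at-⊑-≤ E t (suc j) j≤)) at≡) c l₀ , inj₁ refl
    ... | inj₂ l₀ = _ , rv-load⊥ (trans (sym (at-⊑-≤ E t (suc j) j≤)) at≡) c (trans l₀ l) , inj₁ refl
    RegV-⊑⁻ wf E {t} {suc j} j≤ (rv-loadI at≡ c l) with Ls-⊑⁻ E t (suc j)
    ... | inj₁ l₀ = _ , rv-load⊥ (trans (sym (at-⊑-≤ E t (suc j) j≤)) at≡) c l₀ , inj₁ refl
    ... | inj₂ l₀ = _ , rv-loadI (trans (sym (at-⊑-≤ E t (suc j) j≤)) at≡) c (trans l₀ l) , inj₂ refl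
    RegV-⊑⁻ {s} wf E {t} {suc j} j≤ (rv-loadS {t' = t'} {i'} at≡ c l at≡' c' ev) with Ls-⊑⁻ E t (suc j)
    ... | inj₁ l₀ = _ , rv-load⊥ (trans (sym (at-⊑-≤ E t (suc j) j≤)) at≡) c l₀ , inj₁ refl
    ... | inj₂ l₀ with read-fetched wf (trans l₀ l)
    ...   | ι , at≡₀ with trans (sym (at-⊑ E t' i' at≡₀)) at≡'
    ...     | refl = let (v , ev₀ , v≼) = EvalE-⊑⁻ wf E (at⇒pred≤length (Fs s t') i' at≡₀) ev in
                     v , rv-loadS (trans (sym (at-⊑-≤ E t (suc j) j≤)) at≡) c (trans l₀ l) at≡₀ c' ev₀ , v≼

    EvalE-⊑⁻ : ∀ {s s'} → WellFormed s → s ⊑ s' → ∀ {t j e w} → j ≤ length (Fs s t) → EvalE s' t j e w →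
               Σ (Val {nD} {nR}) λ v → EvalE s t j e v × v ≼ w
    EvalE-⊑⁻ wf E j≤ ev-const = _ , ev-const , inj₂ refl
    EvalE-⊑⁻ wf E j≤ (ev-reg rv) = let (v , rv₀ , v≼) = RegV-⊑⁻ wf E j≤ rv in v , ev-reg rv₀ , v≼
    EvalE-⊑⁻ wf E j≤ (ev-fun {f = f} args) =
      let (vs , args₀ , vs≼) = EvalArgs-⊑⁻ wf E j≤ args in liftF f vs , ev-fun args₀ , liftF-≼ f vs≼

    EvalArgs-⊑⁻ : ∀ {s s'} → WellFormed s → s ⊑ s' → ∀ {t j k} {es : Vec (Expr {nD} {nR}) k} {ws} →
                  j ≤ length (Fs s t) → EvalArgs s' t j es ws →
                  Σ (Vec (Val {nD} {nR}) k) λ vs → EvalArgs s t j es vs × Pointwise _≼_ vs ws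
    EvalArgs-⊑⁻ wf E j≤ ea-nil = [] , ea-nil , []
    EvalArgs-⊑⁻ wf E j≤ (ea-cons ev args) =
      let (v , ev₀ , v≼) = EvalE-⊑⁻ wf E j≤ ev ; (vs , args₀ , vs≼) = EvalArgs-⊑⁻ wf E j≤ args in
      v ∷ vs , ea-cons ev₀ args₀ , v≼ ∷ vs≼

  mutual
    RegV-functional : ∀ {s : St} {t j r v w} → RegV s t j r v → RegV s t j r w → v ≡ w
    RegV-functional rv-none rv-none = refl
    RegV-functional (rv-skip _ rv) (rv-skip _ rw) = RegV-functional rv rw
    RegV-functional {s} {t} {suc j} {r} (rv-skip d _) (rv-assign at≡ c _) =
      skip-clash (Fs s t) (suc j) r d at≡ c (isYes-≟-refl Fin._≟_ r)
    RegV-functional {s} {t} {suc j} {r} (rv-skip d _) (rv-load⊥ at≡ c _) =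
      skip-clash (Fs s t) (suc j) r d at≡ c (isYes-≟-refl Fin._≟_ r)
    RegV-functional {s} {t} {suc j} {r} (rv-skip d _) (rv-loadI at≡ c _) =
      skip-clash (Fs s t) (suc j) r d at≡ c (isYes-≟-refl Fin._≟_ r)
    RegV-functional {s} {t} {suc j} {r} (rv-skip d _) (rv-loadS at≡ c _ _ _ _) =
      skip-clash (Fs s t) (suc j) r d at≡ c (isYes-≟-refl Fin._≟_ r)
    RegV-functional {s} {t} {suc j} {r} (rv-assign at≡ c _) (rv-skip d _) =
      skip-clash (Fs s t) (suc j) r d at≡ c (isYes-≟-refl Fin._≟_ r)
    RegV-functional {s} {t} {suc j} {r} (rv-load⊥ at≡ c _) (rv-skip d _) =
      skip-clash (Fs s t) (suc j) r d at≡ c (isYes-≟-refl Fin._≟_ r)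
    RegV-functional {s} {t} {suc j} {r} (rv-loadI at≡ c _) (rv-skip d _) =
      skip-clash (Fs s t) (suc j) r d at≡ c (isYes-≟-refl Fin._≟_ r)
    RegV-functional {s} {t} {suc j} {r} (rv-loadS at≡ c _ _ _ _) (rv-skip d _) =
      skip-clash (Fs s t) (suc j) r d at≡ c (isYes-≟-refl Fin._≟_ r)
    RegV-functional (rv-assign at≡ c ev) (rv-assign at≡' c' ew) with same-cmd at≡ at≡' c c'
    ... | refl = EvalE-functional ev ew
    RegV-functional (rv-assign at≡ c _) (rv-load⊥ at≡' c' _) with same-cmd at≡ at≡' c c'
    ... | ()
    RegV-functional (rv-assign at≡ c _) (rv-loadI at≡' c' _) with same-cmd at≡ at≡' c c'
    ... | ()
    RegV-functional (rv-assign at≡ c _) (rv-loadS at≡' c' _ _ _ _) with same-cmd at≡ at≡' c c'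
    ... | ()
    RegV-functional (rv-load⊥ at≡ c _) (rv-assign at≡' c' _) with same-cmd at≡ at≡' c c'
    ... | ()
    RegV-functional (rv-loadI at≡ c _) (rv-assign at≡' c' _) with same-cmd at≡ at≡' c c'
    ... | ()
    RegV-functional (rv-loadS at≡ c _ _ _ _) (rv-assign at≡' c' _) with same-cmd at≡ at≡' c c'
    ... | ()
    RegV-functional (rv-load⊥ _ _ _) (rv-load⊥ _ _ _) = refl
    RegV-functional (rv-load⊥ _ _ l) (rv-loadI _ _ l') with trans (sym l) l'
    ... | ()
    RegV-functional (rv-load⊥ _ _ l) (rv-loadS _ _ l' _ _ _) with trans (sym l) l'
    ... | ()
    RegV-functional (rv-loadI _ _ l) (rv-load⊥ _ _ l') with trans (sym l) l'
    ... | ()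
    RegV-functional (rv-loadS _ _ l _ _ _) (rv-load⊥ _ _ l') with trans (sym l) l'
    ... | ()
    RegV-functional (rv-loadI _ _ _) (rv-loadI _ _ _) = refl
    RegV-functional (rv-loadI _ _ l) (rv-loadS _ _ l' _ _ _) with trans (sym l) l'
    ... | ()
    RegV-functional (rv-loadS _ _ l _ _ _) (rv-loadI _ _ l') with trans (sym l) l'
    ... | ()
    RegV-functional (rv-loadS _ _ l at≡ c ev) (rv-loadS _ _ l' at≡' c' ew) with trans (sym l) l'
    ... | refl with same-cmd at≡ at≡' c c'
    ...   | refl = EvalE-functional ev ew

    EvalE-functional : ∀ {s : St} {t j e v w} → EvalE s t j e v → EvalE s t j e w → v ≡ w
    EvalE-functional ev-const ev-const = refl
    EvalE-functional (ev-reg rv) (ev-reg rw) = RegV-functional rv rw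
    EvalE-functional (ev-fun {f = f} args) (ev-fun args') = cong (liftF f) (EvalArgs-functional args args')

    EvalArgs-functional : ∀ {s : St} {t j k} {es : Vec (Expr {nD} {nR}) k} {vs ws} →
                          EvalArgs s t j es vs → EvalArgs s t j es ws → vs ≡ ws
    EvalArgs-functional ea-nil ea-nil = refl
    EvalArgs-functional (ea-cons ev args) (ea-cons ew args') =
      cong₂ _∷_ (EvalE-functional ev ew) (EvalArgs-functional args args')

  GetAddr-functional : ∀ {s : St} {t i x y} → GetAddr s t i x → GetAddr s t i y → x ≡ y
  GetAddr-functional (ga-expr at≡ c ev) (ga-expr at≡' c' ew) with trans (sym at≡) at≡'
  ... | refl with trans (sym c) c'
  ...   | refl = cong liftV (EvalE-functional ev ew)
  GetAddr-functional (ga-expr at≡ c _) (ga-top at≡' c') with trans (sym at≡) at≡'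
  ... | refl with trans (sym c) c'
  ...   | ()
  GetAddr-functional (ga-top at≡ c) (ga-expr at≡' c' _) with trans (sym at≡) at≡'
  ... | refl with trans (sym c) c'
  ...   | ()
  GetAddr-functional (ga-top _ _) (ga-top _ _) = refl

  GetAddr-⊑ : ∀ {s s'} → s ⊑ s' → ∀ {t i x} → x ≢ bot → GetAddr s t i x → GetAddr s' t i x
  GetAddr-⊑ {s} E {t} {i} x↓ (ga-expr at≡ c ev) =
    ga-expr (at-⊑ E t i at≡) c (EvalE-⊑ E (at⇒pred≤length (Fs s t) i at≡) (λ { refl → x↓ refl }) ev)
  GetAddr-⊑ E {t} {i} _ (ga-top at≡ c) = ga-top (at-⊑ E t i at≡) c

  GetAddr-⊑⁻ : ∀ {s s'} → WellFormed s → s ⊑ s' → ∀ {t i x} → i ≤ length (Fs s t) →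
               GetAddr s' t i x → GetAddr s t i x ⊎ GetAddr s t i bot
  GetAddr-⊑⁻ wf E {t} {i} i≤ (ga-top at≡ c) = inj₁ (ga-top (trans (sym (at-⊑-≤ E t i i≤)) at≡) c)
  GetAddr-⊑⁻ wf E {t} {i} i≤ (ga-expr at≡ c ev) with EvalE-⊑⁻ wf E (≤-trans (m∸n≤m i 1) i≤) ev
  ... | _ , ev₀ , inj₁ refl = inj₂ (ga-expr (trans (sym (at-⊑-≤ E t i i≤)) at≡) c ev₀)
  ... | _ , ev₀ , inj₂ refl = inj₁ (ga-expr (trans (sym (at-⊑-≤ E t i i≤)) at≡) c ev₀)

  KeyLt-just : ∀ {x m} → KeyLt {nD} {nR} {n} (just x) m → Σ ℚ λ y → m ≡ just y × x ℚ.< y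
  KeyLt-just {m = just y} x<y = y , refl , x<y

  IsStoreAt⇒Fetched : ∀ (s : St) t i → IsStoreAt (Fs s t) i → Fetched s (st t i)
  IsStoreAt⇒Fetched _ _ _ (ι , eq , _) = ι , eq

  module _ {s : St} {t : Fin n} where

    ⊑-appendF : ∀ {ι} → s ⊑ appendF s t ι
    ⊑-appendF {ι} = record
      { F-prefix      = Fs-appendF s t ι
      ; L-kept        = λ {t'} {m} eq → trans (Ls-appendF s t ι t' m) eq
      ; C-kept        = λ {t'} {m} eq → trans (Cs-appendF s t ι t' m) eq
      ; co-kept       = id
      ; prop-key-mono = prop-key-kept {s} {appendF s t ι} id (λ _ _ → refl)
      }

    ⊑-setC : ∀ {i} → s ⊑ setC s t i
    ⊑-setC {i} = record
      { F-prefix      = unchanged-prefix ∘ Fs-setC s t i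
      ; L-kept        = λ {t'} {m} eq → trans (Ls-setC s t i t' m) eq
      ; C-kept        = C-kept′
      ; co-kept       = id
      ; prop-key-mono = prop-key-kept {s} {setC s t i} id (λ _ _ → refl)
      }
      where
      C-kept′ : ∀ {t' m} → Cs s t' m ≡ true → Cs (setC s t i) t' m ≡ true
      C-kept′ {t'} {m} eq with decide-pair Fin._≟_ ℕ._≟_ t' t m i
      ... | inj₁ (refl , refl) = Cs-setC-same s t i
      ... | inj₂ ne            = trans (Cs-setC-other s t i ne) eq

    ⊑-setL : ∀ {i x} → Ls s t i ≡ nothing → s ⊑ setL s t i x
    ⊑-setL {i} {x} unread = record
      { F-prefix      = unchanged-prefix ∘ Fs-setL s t i x
      ; L-kept        = L-kept′
      ; C-kept        = λ {t'} {m} eq → trans (Cs-setL s t i x t' m) eq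
      ; co-kept       = id
      ; prop-key-mono = prop-key-kept {s} {setL s t i x} id (λ _ _ → refl)
      }
      where
      L-kept′ : ∀ {t' m src} → Ls s t' m ≡ just src → Ls (setL s t i x) t' m ≡ just src
      L-kept′ {t'} {m} eq with decide-pair Fin._≟_ ℕ._≟_ t' t m i
      ... | inj₁ (refl , refl) with () ← trans (sym unread) eq
      ... | inj₂ ne            = trans (Ls-setL-other s t i x ne) eq

    ⊑-setCo : ∀ {i k} → State.co s t i ≡ nothing → s ⊑ setCo s t i k
    ⊑-setCo {i} {k} unkeyed = record
      { F-prefix      = λ _ → unchanged-prefix refl
      ; L-kept        = id
      ; C-kept        = id
      ; co-kept       = co-kept′
      ; prop-key-mono = prop-key-kept {s} {setCo s t i k} co-kept′ (λ _ _ → refl)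
      }
      where
      co-kept′ : ∀ {t' m k'} → State.co s t' m ≡ just k' → State.co (setCo s t i k) t' m ≡ just k'
      co-kept′ {t'} {m} eq with decide-pair Fin._≟_ ℕ._≟_ t' t m i
      ... | inj₁ (refl , refl) with () ← trans (sym unkeyed) eq
      ... | inj₂ ne            = trans (co-setCo-other s t i k ne) eq

    ⊑-setProp : ∀ {a x} → KeyLt {nD} {nR} {n} (coS s (State.prop s t a)) (coS s x) → s ⊑ setProp s t a x
    ⊑-setProp {a} {x} newer = record
      { F-prefix      = λ _ → unchanged-prefix refl
      ; L-kept        = id
      ; C-kept        = id
      ; co-kept       = id
      ; prop-key-mono = prop-key-mono′
      }
      where
      prop-key-mono′ : ∀ {t' a' x₀} → coS s (State.prop s t' a') ≡ just x₀ →
                       Σ ℚ λ y → coS (setProp s t a x) (State.prop (setProp s t a x) t' a') ≡ just y × x₀ ℚ.≤ y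
      prop-key-mono′ {t'} {a'} {x₀} eq with decide-pair Fin._≟_ Fin._≟_ t' t a' a
      ... | inj₁ (refl , refl) =
        let (y , eq' , x₀<y) = KeyLt-just (subst (λ m → KeyLt {nD} {nR} {n} m (coS s x)) eq newer) in
        y , trans (cong (coS _) (prop-setProp-same s t a x)) (coS-kept {s} {setProp s t a x} id x eq') , ℚ.<⇒≤ x₀<y
      ... | inj₂ ne =
        x₀ , trans (cong (coS _) (prop-setProp-other s t a x ne)) (coS-kept {s} {setProp s t a x} id (State.prop s t' a') eq) ,
        ℚ.≤-refl

    appendF-wf : ∀ {ι} → WellFormed s → WellFormed (appendF s t ι)
    appendF-wf {ι} wf = WellFormed-⊑ wf ⊑-appendF
      (λ {t'} {m} eq → inj₁ (trans (sym (Ls-appendF s t ι t' m)) eq)) (λ _ _ → inj₁ refl) inj₁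

    setC-wf : ∀ {i} → WellFormed s → WellFormed (setC s t i)
    setC-wf {i} wf = WellFormed-⊑ wf ⊑-setC
      (λ {t'} {m} eq → inj₁ (trans (sym (Ls-setC s t i t' m)) eq)) (λ _ _ → inj₁ refl) inj₁

    setL-wf : ∀ {i x} → WellFormed s → (unread : Ls s t i ≡ nothing) → Fetched s x → WellFormed (setL s t i x)
    setL-wf {i} {x} wf unread fx = WellFormed-⊑ wf (⊑-setL unread) new-read (λ _ _ → inj₁ refl) inj₁
      where
      new-read : ∀ {t' m src} → Ls (setL s t i x) t' m ≡ just src →
                 Ls s t' m ≡ just src ⊎ Fetched (setL s t i x) src
      new-read {t'} {m} eq with decide-pair Fin._≟_ ℕ._≟_ t' t m i
      ... | inj₁ (refl , refl) with refl ← trans (sym (Ls-setL-same s t i x)) eq =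
        inj₂ (Fetched-⊑ (⊑-setL unread) x fx)
      ... | inj₂ ne = inj₁ (trans (sym (Ls-setL-other s t i x ne)) eq)

    setCo-wf : ∀ {i k} → WellFormed s → (unkeyed : State.co s t i ≡ nothing) → Cs s t i ≡ true →
               WellFormed (setCo s t i k)
    setCo-wf {i} {k} wf unkeyed committed =
      WellFormed-⊑ wf (⊑-setCo unkeyed) inj₁ (λ _ _ → inj₁ refl) new-key
      where
      new-key : ∀ {t' m k'} → State.co (setCo s t i k) t' m ≡ just k' →
                State.co s t' m ≡ just k' ⊎ Cs s t' m ≡ true
      new-key {t'} {m} eq with decide-pair Fin._≟_ ℕ._≟_ t' t m i
      ... | inj₁ (refl , refl) = inj₂ committed
      ... | inj₂ ne            = inj₁ (trans (sym (co-setCo-other s t i k ne)) eq)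

    setProp-wf : ∀ {a x} → WellFormed s → (newer : KeyLt {nD} {nR} {n} (coS s (State.prop s t a)) (coS s x)) →
                 Fetched s x → WellFormed (setProp s t a x)
    setProp-wf {a} {x} wf newer fx = WellFormed-⊑ wf (⊑-setProp newer) inj₁ new-prop inj₁
      where
      new-prop : ∀ t' a' → State.prop (setProp s t a x) t' a' ≡ State.prop s t' a' ⊎
                           Fetched (setProp s t a x) (State.prop (setProp s t a x) t' a')
      new-prop t' a' with decide-pair Fin._≟_ Fin._≟_ t' t a' a
      ... | inj₁ (refl , refl) =
        inj₂ (subst (Fetched _) (sym (prop-setProp-same s t a x)) (Fetched-⊑ (⊑-setProp newer) x fx))
      ... | inj₂ ne            = inj₁ (prop-setProp-other s t a x ne)

  coL-read : ∀ {s : St} {t i src} → Ls s t i ≡ just src → coL s t i ≡ coS s src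
  coL-read eq rewrite eq = refl

  module _ {P : Program {nD} {nR} n} where

    step-⊑-wf : ∀ {s l s'} → WellFormed s → Step P s l s' → s ⊑ s' × WellFormed s'
    step-⊑-wf wf (s-fetch _ _) = ⊑-appendF , appendF-wf wf
    step-⊑-wf wf (s-load {t} {i} {a} _ unread _) = ⊑-setL unread , setL-wf wf unread (prop-fetched wf t a)
    step-⊑-wf {s} wf (s-early {t} {i} {i'} pre) =
      ⊑-setL (EarlyPre.unread pre) ,
      setL-wf wf (EarlyPre.unread pre) (IsStoreAt⇒Fetched s t i' (EarlyPre.isStore pre))
    step-⊑-wf wf (s-commit _ _) = ⊑-setC , setC-wf wf
    step-⊑-wf {s} wf (s-store {t} {i} {k} {a} isS pre _ _ _ newer) =
      ⊑-trans E₂ (⊑-setProp newer₂) ,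
      setProp-wf wf₂ newer₂ (Fetched-⊑ E₂ (st t i) (IsStoreAt⇒Fetched s t i isS))
      where
      unkeyed = uncommitted-unkeyed wf (CommitPre.notC pre)
      s₂ = setCo (setC s t i) t i k
      E₂ : s ⊑ s₂
      E₂ = ⊑-trans ⊑-setC (⊑-setCo unkeyed)
      wf₂ : WellFormed s₂
      wf₂ = setCo-wf (setC-wf wf) unkeyed (Cs-setC-same s t i)
      -- The propagated store keeps its key, since the committed store had none before.
      newer₂ : KeyLt {nD} {nR} {n} (coS s₂ (State.prop s₂ t a)) (coS s₂ (st t i))
      newer₂ = let (x , key) = prop-keyed wf t a in
        subst₂ (KeyLt {nD} {nR} {n}) (sym (coS-kept (co-kept E₂) (State.prop s t a) key))
                                     (sym (co-setCo-same (setC s t i) t i k))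
               (subst (λ m → KeyLt {nD} {nR} {n} m (just k)) key newer)
    step-⊑-wf {s} wf (s-prop {t' = t'} {i'} _ isS _ newer) =
      ⊑-setProp newer , setProp-wf wf newer (IsStoreAt⇒Fetched s t' i' isS)

    step-⊑ : ∀ {s l s'} → WellFormed s → Step P s l s' → s ⊑ s'
    step-⊑ wf stp = proj₁ (step-⊑-wf wf stp)

    step-wf : ∀ {s l s'} → WellFormed s → Step P s l s' → WellFormed s'
    step-wf wf stp = proj₂ (step-⊑-wf wf stp)

    run-⊑-wf : ∀ {s σ s'} → WellFormed s → Run P s σ s' → s ⊑ s' × WellFormed s'
    run-⊑-wf wf done = ⊑-refl , wf
    run-⊑-wf wf (step stp ρ) =
      let (E₁ , wf₁) = step-⊑-wf wf stp ; (E₂ , wf₂) = run-⊑-wf wf₁ ρ in ⊑-trans E₁ E₂ , wf₂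

    run-⊑ : ∀ {s σ s'} → WellFormed s → Run P s σ s' → s ⊑ s'
    run-⊑ wf ρ = proj₁ (run-⊑-wf wf ρ)

    run-split : ∀ σ₁ {σ₂ s s'} → Run P s (σ₁ ++ σ₂) s' → Σ St λ s₁ → Run P s σ₁ s₁ × Run P s₁ σ₂ s'
    run-split []       ρ            = _ , done , ρ
    run-split (_ ∷ σ₁) (step stp ρ) = let (s₁ , ρ₁ , ρ₂) = run-split σ₁ ρ in s₁ , step stp ρ₁ , ρ₂

    record StepIn (s : St) (l : Lab) (s' : St) : Set where
      constructor step-in
      field
        {before after} : St
        reach   : s ⊑ before
        wf      : WellFormed before
        taken   : Step P before l after
        rest    : after ⊑ s'

    step-in-run : ∀ {s σ s' l} → WellFormed s → Run P s σ s' → l ∈ σ → StepIn s l s'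
    step-in-run wf (step stp ρ) (Any.here refl) = step-in ⊑-refl wf stp (run-⊑ (step-wf wf stp) ρ)
    step-in-run wf (step stp ρ) (Any.there l∈σ) =
      let step-in E wf′ stp′ E′ = step-in-run (step-wf wf stp) ρ l∈σ
      in step-in (⊑-trans (step-⊑ wf stp) E) wf′ stp′ E′

    -- Commits in runs

    commitS-inv : ∀ {s s' t i k a} → Step P s (commitS t i k a) s' →
                  IsStoreAt (Fs s t) i × CommitPre s t i × GetAddr s t i (val a) ×
                  KeyLt {nD} {nR} {n} (coS s (State.prop s t a)) (just k)
    commitS-inv (s-store isS pre ga _ _ newer) = isS , pre , ga , newer

    commitS-key : ∀ {s s' t i k a} → Step P s (commitS t i k a) s' → State.co s' t i ≡ just k
    commitS-key {s} (s-store {t} {i} {k} _ _ _ _ _ _) = co-setCo-same (setC s t i) t i k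

    store-commit-label : ∀ {s l s' t m} → Step P s l s' → Cs s t m ≡ false → Cs s' t m ≡ true → IsStoreAt (Fs s t) m →
                         Σ ℚ λ k → Σ (D {nD} {nR}) λ a → l ≡ commitS t m k a × GetAddr s t m (val a)
    store-commit-label {s} {t = t} {m} (s-fetch {t₀} {ι} _ _) c₀ c₁ _ = no-flip (Cs-appendF s t₀ ι t m) c₀ c₁
    store-commit-label {s} {t = t} {m} (s-load {t₀} {i} _ _ _) c₀ c₁ _ = no-flip (Cs-setL s t₀ i _ t m) c₀ c₁
    store-commit-label {s} {t = t} {m} (s-early {t₀} {i} _) c₀ c₁ _ = no-flip (Cs-setL s t₀ i _ t m) c₀ c₁
    store-commit-label (s-prop _ _ _ _) c₀ c₁ _ = no-flip refl c₀ c₁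
    store-commit-label {s} {t = t} {m} (s-commit {t₀} {i} notStore _) c₀ c₁ isS
      with decide-pair Fin._≟_ ℕ._≟_ t t₀ m i
    ... | inj₁ (refl , refl) = ⊥-elim (notStore isS)
    ... | inj₂ ne            = no-flip (Cs-setC-other s t₀ i ne) c₀ c₁
    store-commit-label {s} {t = t} {m} (s-store {t₀} {i} {k} {a} _ _ ga _ _ _) c₀ c₁ _
      with decide-pair Fin._≟_ ℕ._≟_ t t₀ m i
    ... | inj₁ (refl , refl) = k , a , refl , ga
    ... | inj₂ ne            = no-flip (Cs-setC-other s t₀ i ne) c₀ c₁

    commitS-occurs : ∀ {s σ s' t m a} → WellFormed s → Run P s σ s' → Cs s t m ≡ false → Cs s' t m ≡ true →
                     IsStoreAt (Fs s t) m → GetAddr s t m (val a) → Σ ℚ λ k → commitS t m k a ∈ σ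
    commitS-occurs wf done c₀ c₁ _ _ = no-flip refl c₀ c₁
    commitS-occurs {t = t} {m} wf (step {s' = s₁} stp ρ) c₀ c₁ isS ga with Cs s₁ t m in c
    ... | false =
      let E = step-⊑ wf stp
          (k , l∈σ) = commitS-occurs (step-wf wf stp) ρ c c₁ (IsStoreAt-⊑ E t m isS) (GetAddr-⊑ E val≢bot ga)
      in k , Any.there l∈σ
    ... | true with store-commit-label stp c₀ c isS
    ...   | k , _ , refl , ga' with refl ← val-injective (GetAddr-functional ga' ga) = k , Any.here refl

    commit-eventually : ∀ {s σ sf t m a} → WellFormed s → Run P s σ sf → Final sf → Cs s t m ≡ false →
                        IsStoreAt (Fs s t) m → GetAddr s t m (val a) → Σ ℚ λ k → commitS t m k a ∈ σ
    commit-eventually {sf = sf} {t} {m} wf ρ fin c₀ isS ga =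
      let (_ , at≡ , _) = IsStoreAt-⊑ (run-⊑ wf ρ) t m isS ; (1≤m , m≤) = at-bounds (Fs sf t) m at≡ in
      commitS-occurs wf ρ c₀ (Final.allCommitted fin t m 1≤m m≤) isS ga

    -- COMMIT of m requires every earlier instruction with address a or ⊥ to be committed, i in particular.
    same-address-commits-in-order : ∀ {s σ₁ σ₂ sf t i m k k' a} → WellFormed s →
                                    Run P s (σ₁ ++ commitS t i k a ∷ σ₂) sf → commitS t m k' a ∈ σ₁ → i < m → ⊥
    same-address-commits-in-order {σ₁ = σ₁} {t = t} {i} wf ρ m∈σ₁ i<m
      with run-split σ₁ ρ
    ... | sb , ρ₁ , step stpᵢ _ with step-in-run wf ρ₁ m∈σ₁
    ...   | step-in {sc} _ wfc stpₘ E =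
      let (_ , preᵢ , gaᵢ , _) = commitS-inv stpᵢ
          ((_ , atₘ , _) , preₘ , gaₘ , _) = commitS-inv stpₘ
          Ecb = ⊑-trans (step-⊑ wfc stpₘ) E
          i≤ = ≤-trans (<⇒≤ i<m) (proj₂ (at-bounds (Fs sc t) _ atₘ))
          committed = CommitPre.order preₘ _ gaₘ i i<m (GetAddr-⊑⁻ wfc Ecb i≤ gaᵢ)
      in false≢true (trans (sym (CommitPre.notC preᵢ)) (C-kept Ecb committed))

    -- EARLY reads

    module _ {s : St} {t : Fin n} {i i' : ℕ} {a : D {nD} {nR}} (wf : WellFormed s) (pre : EarlyPre s t i i' a) where

      private
        s₁ = setL s t i (st t i')
        E₁ : s ⊑ s₁
        E₁ = step-⊑ wf (s-early {P = P} pre)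
        wf₁ : WellFormed s₁
        wf₁ = step-wf wf (s-early {P = P} pre)

      early-store-commits : ∀ {σ sf} → Run P s₁ σ sf → Final sf → Σ ℚ λ k → commitS t i' k a ∈ σ
      early-store-commits ρ fin =
        commit-eventually wf₁ ρ fin (trans (Cs-setL s t i _ t i') (EarlyPre.notC' pre))
          (IsStoreAt-⊑ E₁ t i' (EarlyPre.isStore pre)) (GetAddr-⊑ E₁ val≢bot (EarlyPre.addr' pre))

      early-excludes-later-commit : ∀ {σ sf j k} → Run P s₁ σ sf → commitS t j k a ∈ σ → i' < j → j < i → ⊥
      early-excludes-later-commit {j = j} ρ j∈σ i'<j j<i with step-in-run wf₁ ρ j∈σ
      ... | step-in E _ stp _ =
        let (isS , _ , ga , _) = commitS-inv stp
            (_ , atᵢ , _) = EarlyPre.isLoad pre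
            j≤ = ≤-trans (<⇒≤ j<i) (proj₂ (at-bounds (Fs s t) i atᵢ))
            E′ = ⊑-trans E₁ E
        in EarlyPre.greatest pre j i'<j j<i (IsStoreAt-⊑⁻ E′ t j j≤ isS) (GetAddr-⊑⁻ wf E′ j≤ ga)

      early-source-determined : ∀ {σ₂ σ₃ sf i₀ k} → Run P s₁ (σ₂ ++ commitS t i₀ k a ∷ σ₃) sf → Final sf →
                                i₀ < i → (∀ j k' → i₀ < j → j < i → commitS t j k' a ∉ σ₃) → i' ≡ i₀
      early-source-determined {σ₂} {i₀ = i₀} ρ fin i₀<i later-free with <-cmp i' i₀
      ... | tri≈ _ i'≡i₀ _ = i'≡i₀
      ... | tri< i'<i₀ _ _ = ⊥-elim (early-excludes-later-commit ρ (∈-++⁺ʳ σ₂ (Any.here refl)) i'<i₀ i₀<i)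
      ... | tri> _ _ i₀<i' with early-store-commits ρ fin
      ...   | k' , i'∈σ with ∈-++⁻ σ₂ i'∈σ
      ...     | inj₁ i'∈σ₂            = ⊥-elim (same-address-commits-in-order wf₁ ρ i'∈σ₂ i₀<i')
      ...     | inj₂ (Any.here refl)  = ⊥-elim (<-irrefl refl i₀<i')
      ...     | inj₂ (Any.there i'∈σ₃) = ⊥-elim (later-free i' k' i₀<i' (EarlyPre.before pre) i'∈σ₃)

    load-precedes-no-older-commit : ∀ {s t i a σ₂ σ₃ sf i' k} → WellFormed s → (unread : Ls s t i ≡ nothing) →
      GetAddr s t i (val a) → Run P (setL s t i (State.prop s t a)) (σ₂ ++ commitS t i' k a ∷ σ₃) sf →
      Final sf → IsLoadAt (Fs sf t) i → IsStoreAt (Fs sf t) i' → i' < i → ⊥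
    load-precedes-no-older-commit {s} {t} {i} {a} {σ₂} {sf = sf} {i'} {k} wf unread ga ρ fin isL isS i'<i
      with prop-keyed wf t a
         | step-in-run (setL-wf wf unread (prop-fetched wf t a)) ρ (∈-++⁺ʳ σ₂ (Any.here refl))
    ... | x , read-key | step-in E wfb stp E′
      with commitS-inv stp | prop-key-mono (⊑-trans (⊑-setL unread) E) read-key
    ... | _ , _ , ga′ , newer | y , key-at-commit , x≤y =
      ℚ.<-irrefl refl (ℚ.≤-<-trans (ℚ.≤-trans k≤x x≤y) y<k)
      where
      ρ-⊑ = run-⊑ (setL-wf wf unread (prop-fetched wf t a)) ρ
      E-sf = ⊑-trans (⊑-setL unread) ρ-⊑
      y<k : y ℚ.< k
      y<k = subst (λ m → KeyLt {nD} {nR} {n} m (just k)) key-at-commit newer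
      read≡ : coL sf t i ≡ just x
      read≡ = trans (coL-read {sf} {t} {i} (L-kept ρ-⊑ (Ls-setL-same s t i _)))
                    (coS-kept {s} {sf} (co-kept E-sf) (State.prop s t a) read-key)
      k≤x : k ℚ.≤ x
      k≤x = subst₂ (KeyLe {nD} {nR} {n}) (co-kept E′ (commitS-key stp)) read≡
              (Final.storeLoad fin t i' i a i'<i isS isL
                 (GetAddr-⊑ (⊑-trans (step-⊑ wfb stp) E′) val≢bot ga′) (GetAddr-⊑ E-sf val≢bot ga))

    EarlyPattern : List Lab → Fin n → ℕ → ℕ → Set
    EarlyPattern σ t i i' =
      Σ (D {nD} {nR}) λ a → Σ ℚ λ k → Σ (List Lab) λ σ₁ → Σ (List Lab) λ σ₂ → Σ (List Lab) λ σ₃ →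
      (σ ≡ σ₁ ++ ld t i a ∷ σ₂ ++ commitS t i' k a ∷ σ₃) ×
      1 ≤ i' × i' < i ×
      (∀ j k' → i' < j → j < i → commitS t j k' a ∉ σ₃)

    EarlyPattern-∷ : ∀ {σ t i i'} l → EarlyPattern σ t i i' → EarlyPattern (l ∷ σ) t i i'
    EarlyPattern-∷ l (a , k , σ₁ , σ₂ , σ₃ , eq , rest) = a , k , l ∷ σ₁ , σ₂ , σ₃ , cong (l ∷_) eq , rest

    early⇒pattern : ∀ {s σ sf t i i'} → WellFormed s → (ρ : Run P s σ sf) → Final sf →
                    EarlyIn ρ t i i' → EarlyPattern σ t i i'
    early⇒pattern wf (step stp ρ) fin (there e) = EarlyPattern-∷ _ (early⇒pattern (step-wf wf stp) ρ fin e)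
    early⇒pattern {s} wf _ fin (here {t = t} {i} {i'} {a} {pre} {ρ})
      with early-store-commits wf pre ρ fin
    ... | k , i'∈σ with σ₂ , σ₃ , refl ← ∈-∃++ i'∈σ =
      a , k , [] , σ₂ , σ₃ , refl , proj₁ (at-bounds (Fs s t) i' at≡) , EarlyPre.before pre ,
      λ j k' i'<j j<i j∈σ₃ → early-excludes-later-commit wf pre ρ (∈-++⁺ʳ σ₂ (Any.there j∈σ₃)) i'<j j<i
      where at≡ = proj₁ (proj₂ (EarlyPre.isStore pre))

    pattern⇒early : ∀ {s σ sf t i i'} → WellFormed s → (ρ : Run P s σ sf) → Final sf →
                    IsLoadAt (Fs sf t) i → IsStoreAt (Fs sf t) i' → EarlyPattern σ t i i' → EarlyIn ρ t i i'
    pattern⇒early wf (step stp ρ) fin isL isS (a , k , _ ∷ σ₁ , σ₂ , σ₃ , refl , rest) =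
      there (pattern⇒early (step-wf wf stp) ρ fin isL isS (a , k , σ₁ , σ₂ , σ₃ , refl , rest))
    pattern⇒early wf (step (s-load _ unread ga) ρ) fin isL isS (_ , _ , [] , _ , _ , refl , _ , i'<i , _) =
      ⊥-elim (load-precedes-no-older-commit wf unread ga ρ fin isL isS i'<i)
    pattern⇒early wf (step (s-early pre) ρ) fin isL isS (_ , _ , [] , _ , _ , refl , _ , i'<i , later-free)
      with refl ← early-source-determined wf pre ρ fin i'<i later-free = here

lemma4 : ∀ {nD nR : ℕ} (n : ℕ) (P : Program {nD} {nR} n)
         (σ : List (Label {nD} {nR} {n})) (sf : State n)
         (ρ : Run P initState σ sf) → Final sf →
         (t : Fin n) (i i' : ℕ) →
         IsLoadAt (Fs sf t) i → IsStoreAt (Fs sf t) i' →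
         let Cond : Set
             Cond = Σ (D {nD} {nR}) λ a → Σ ℚ λ k →
                    Σ (List (Label {nD} {nR} {n})) λ σ₁ → Σ (List (Label {nD} {nR} {n})) λ σ₂ → Σ (List (Label {nD} {nR} {n})) λ σ₃ →
                    (σ ≡ σ₁ ++ ld t i a ∷ σ₂ ++ commitS t i' k a ∷ σ₃) ×
                    1 ≤ i' × i' < i ×
                    (∀ j k' → i' < j → j < i → commitS t j k' a ∉ σ₃)
         in (EarlyIn ρ t i i' → Cond) × (Cond → EarlyIn ρ t i i')
lemma4 n P σ sf ρ fin t i i' isL isS =
  early⇒pattern initState-wf ρ fin , pattern⇒early initState-wf ρ fin isL isS
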